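{- Let $k\ge 2$ and let $\mathcal{H}=(V,E)$ be a $k$-uniform threshold hypergraph given by a binary sequence, with short sequence $C(a_1,\dots,a_r)_k$. If $x$ and $y$ are vertices belonging to the same block, then $x\ll y$ and $y\ll x$.
   Context: Let $k\ge 2$ and $n$ be positive integers and let $(b_1,\dots,b_n)_k$ be a binary sequence ($b_i\in\{0,1\}$) with $b_1=\dots=b_{k-1}=0$. The $k$-uniform threshold hypergraph $\mathcal{H}=(V,E)$ given by this sequence has vertex set $V=\{v_1,\dots,v_n\}$, and a set $e$ is an edge if and only if $e$ is a $k$-element subset of $V$ and $b_j=1$, where $j=\max\{i: v_i\in e\}$. Short sequence: if $b_k=0$, $(a_1,a_2,\dots,a_r)$ are the lengths of the successive maximal runs of equal consecutive entries of $(b_1,\dots,b_n)$ (so $a_1$ is the length of the initial run of zeros, $a_2$ the length of the following run of ones, etc.); if $b_k=1$, $a_1$ is the total length of the first two runs (the initial $k-1$ zeros together with the following run of ones), and $a_2,a_3,\dots,a_r$ are the lengths of the subsequent maximal runs. Thus $a_1+\dots+a_r=n$. Vertices $v_i$ and $v_j$ belong to the same block if there is $t\in\{1,\dots,r\}$ with $a_1+\dots+a_{t-1}<i,j\le a_1+\dots+a_t$ (they then belong to the $t$-th block). For $x,y\in V$, $x\ll y$ means: for every $(k-1)$-element subset $\{x_1,\dots,x_{k-1}\}\subseteq V\setminus\{x,y\}$, if $\{x,x_1,\dots,x_{k-1}\}\in E$ then $\{y,x_1,\dots,x_{k-1}\}\in E$. -}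

module Defs where

open import Data.Bool using (Bool; true; false; if_then_else_)
open import Data.Bool.Properties using () renaming (_≟_ to _≟ᵇ_)
open import Data.Nat using (ℕ; zero; suc; _+_; _∸_; _≤_; _<_)
open import Data.List using (List; []; _∷_; take; length)
open import Data.Nat.ListAction using (sum)
open import Data.Vec using (Vec; lookup; toList)
open import Data.Fin using (Fin; toℕ)
import Data.Fin as Fin
open import Data.Fin.Subset using (Subset; _∈_; _∉_; ∣_∣; _∪_; ⁅_⁆)
open import Data.Product using (_×_; ∃-syntax)
open import Relation.Nullary using (does)
open import Relation.Binary.PropositionalEquality using (_≡_)

-- Vertex v_{i+1} of the paper is  i : Fin n ; the binary sequence is  b : Vec Bool n
-- (true = 1, false = 0), so b_{i+1} = lookup b i.

IsEdge : {n : ℕ} → ℕ → Vec Bool n → Subset n → Set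
IsEdge {n} k b e =
  ∣ e ∣ ≡ k × ∃[ j ] (j ∈ e × lookup b j ≡ true × (∀ i → i ∈ e → i Fin.≤ j))

_≪[_,_]_ : {n : ℕ} → Fin n → ℕ → Vec Bool n → Fin n → Set
_≪[_,_]_ {n} x k b y =
  (S : Subset n) → ∣ S ∣ ≡ k ∸ 1 → x ∉ S → y ∉ S →
  IsEdge k b (⁅ x ⁆ ∪ S) → IsEdge k b (⁅ y ⁆ ∪ S)

runsFrom : Bool → ℕ → List Bool → List ℕ
runsFrom c m [] = m ∷ []
runsFrom c m (y ∷ ys) =
  if does (y ≟ᵇ c) then runsFrom c (suc m) ys else (m ∷ runsFrom y 1 ys)

runs : List Bool → List ℕ
runs [] = []
runs (x ∷ xs) = runsFrom x 1 xs

mergeFirstTwo : List ℕ → List ℕ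
mergeFirstTwo (a ∷ a' ∷ rest) = (a + a') ∷ rest
mergeFirstTwo l = l

-- entry at (0-based) position i, defaulting to 0 (false) out of range
nth : List Bool → ℕ → Bool
nth [] _ = false
nth (x ∷ xs) zero = x
nth (x ∷ xs) (suc i) = nth xs i

-- the short sequence (a_1,…,a_r); b_k is the entry at 0-based position k-1
shortSeq : {n : ℕ} → ℕ → Vec Bool n → List ℕ
shortSeq k b =
  if nth (toList b) (k ∸ 1) then mergeFirstTwo (runs (toList b)) else runs (toList b)

-- v_{i+1} lies in the t-th block (t 1-based, here t+1 with t 0-based) iff
-- a_1+…+a_t < i+1 ≤ a_1+…+a_{t+1}
InBlock : ℕ → ℕ → List ℕ → Set
InBlock t i a = sum (take t a) ≤ i × i < sum (take (suc t) a)

SameBlock : {n : ℕ} → ℕ → Vec Bool n → Fin n → Fin n → Set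
SameBlock k b x y =
  ∃[ t ] (t < length (shortSeq k b) ×
          InBlock t (toℕ x) (shortSeq k b) × InBlock t (toℕ y) (shortSeq k b))

module Submission where

-- Within one block of the short sequence the bit b_j is constant, except in a
-- merged first block, which is a run of k-1 zeros followed by ones; there every
-- position j ≥ k-1 carries a 1. Now take S with |S| = k-1 avoiding x and y, and
-- compare the largest vertices j of {x} ∪ S and j' of {y} ∪ S: either j = j', or
-- both lie between x and y, hence in their common block. As |{y} ∪ S| = k, we
-- have j' ≥ k-1, so b_j = 1 forces b_j' = 1.

open import Defs
open import Data.Bool using (Bool; true; false)
open import Data.Bool.Properties using () renaming (_≟_ to _≟ᵇ_)
open import Data.Nat using (ℕ; zero; suc; _+_; _∸_; _≤_; _<_; z≤n; s≤s; s≤s⁻¹)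
open import Data.Nat.Properties
open import Data.List using (List; []; _∷_; replicate; _++_)
open import Data.Vec using (Vec; lookup; toList; []; _∷_)
open import Data.Fin using (Fin; toℕ; zero; suc)
import Data.Fin as Fin
open import Data.Fin.Properties using (toℕ-injective)
open import Data.Fin.Subset using (Subset; _∈_; _∉_; ∣_∣; _∪_; ⁅_⁆; inside; outside; Nonempty)
open import Data.Fin.Subset.Properties
  using (x∈⁅x⁆; x∈⁅y⁆⇒x≡y; x∈p∪q⁻; x∈p∪q⁺; nonempty?; ∪-identityˡ)
open import Data.Vec.Base using (here; there)
open import Data.Product using (_×_; _,_; ∃; ∃-syntax)
open import Data.Sum using (_⊎_; inj₁; inj₂)
open import Relation.Nullary using (¬_; yes; no; contradiction)
open import Relation.Binary.PropositionalEquality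
  using (_≡_; refl; sym; trans; cong; subst; module ≡-Reasoning)
open ≡-Reasoning

∣⁅x⁆∪p∣≡1+∣p∣ : ∀ {n} (x : Fin n) (p : Subset n) → x ∉ p → ∣ ⁅ x ⁆ ∪ p ∣ ≡ suc ∣ p ∣
∣⁅x⁆∪p∣≡1+∣p∣ zero    (inside  ∷ p) x∉p = contradiction here x∉p
∣⁅x⁆∪p∣≡1+∣p∣ zero    (outside ∷ p) x∉p = cong (λ q → suc ∣ q ∣) (∪-identityˡ p)
∣⁅x⁆∪p∣≡1+∣p∣ (suc x) (inside  ∷ p) x∉p = cong suc (∣⁅x⁆∪p∣≡1+∣p∣ x p (λ x∈p → x∉p (there x∈p)))
∣⁅x⁆∪p∣≡1+∣p∣ (suc x) (outside ∷ p) x∉p = ∣⁅x⁆∪p∣≡1+∣p∣ x p (λ x∈p → x∉p (there x∈p))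

∀∈p<m⇒∣p∣≤m : ∀ {n} (p : Subset n) m → (∀ i → i ∈ p → toℕ i < m) → ∣ p ∣ ≤ m
∀∈p<m⇒∣p∣≤m []            m       below = z≤n
∀∈p<m⇒∣p∣≤m (outside ∷ p) m       below = ∀∈p<m⇒∣p∣≤m p m (λ i i∈p → <-trans (n<1+n _) (below (suc i) (there i∈p)))
∀∈p<m⇒∣p∣≤m (inside  ∷ p) zero    below = contradiction (below zero here) λ ()
∀∈p<m⇒∣p∣≤m (inside  ∷ p) (suc m) below = s≤s (∀∈p<m⇒∣p∣≤m p m (λ i i∈p → s≤s⁻¹ (below (suc i) (there i∈p))))

IsMaximum : ∀ {n} → Subset n → Fin n → Set
IsMaximum p j = j ∈ p × (∀ i → i ∈ p → i Fin.≤ j)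

maximum : ∀ {n} (p : Subset n) → Nonempty p → ∃ (IsMaximum p)
maximum (s ∷ p) _ with nonempty? p
maximum (s ∷ p) _ | yes ne′ with maximum p ne′
... | j , j∈p , j-max = suc j , there j∈p , below
  where
  below : ∀ i → i ∈ s ∷ p → toℕ i ≤ suc (toℕ j)
  below zero    _           = z≤n
  below (suc i) (there i∈p) = s≤s (j-max i i∈p)
maximum (s ∷ p) (zero  , here)      | no ∅ = zero , here , below
  where
  below : ∀ i → i ∈ inside ∷ p → toℕ i ≤ 0
  below zero    _           = z≤n
  below (suc i) (there i∈p) = contradiction (i , i∈p) ∅
maximum (s ∷ p) (suc i , there i∈p) | no ∅ = contradiction (i , i∈p) ∅

maximum-⁅x⁆∪p : ∀ {n} {x j : Fin n} {p} → IsMaximum (⁅ x ⁆ ∪ p) j → j ≡ x ⊎ j ∈ p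
maximum-⁅x⁆∪p {x = x} {p = p} (j∈ , _) with x∈p∪q⁻ ⁅ x ⁆ p j∈
... | inj₁ j∈⁅x⁆ = inj₁ (x∈⁅y⁆⇒x≡y x j∈⁅x⁆)
... | inj₂ j∈p   = inj₂ j∈p

IsInterval : (ℕ → Set) → Set
IsInterval P = ∀ {p q z} → P p → P q → p ≤ z → z ≤ q → P z

OnesSpreadIn : ℕ → (ℕ → Bool) → (ℕ → Set) → Set
OnesSpreadIn k f P = ∀ {z w} → P z → P w → f z ≡ true → k ∸ 1 ≤ w → f w ≡ true

maxima-equal-or-within : ∀ {n} {P : ℕ → Set} → IsInterval P →
  {x y j j′ : Fin n} {S : Subset n} → P (toℕ x) → P (toℕ y) →
  IsMaximum (⁅ x ⁆ ∪ S) j → IsMaximum (⁅ y ⁆ ∪ S) j′ →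
  j ≡ j′ ⊎ (P (toℕ j) × P (toℕ j′))
maxima-equal-or-within interval {x} {y} {j} {j′} {S} Px Py j-max@(_ , below) j′-max@(_ , below′)
  with maximum-⁅x⁆∪p j-max | maximum-⁅x⁆∪p j′-max
... | inj₁ refl | inj₁ refl = inj₂ (Px , Py)
... | inj₁ refl | inj₂ j′∈S =
  inj₂ (Px , interval Py Px (below′ y (x∈p∪q⁺ (inj₁ (x∈⁅x⁆ y)))) (below j′ (x∈p∪q⁺ (inj₂ j′∈S))))
... | inj₂ j∈S  | inj₁ refl =
  inj₂ (interval Px Py (below x (x∈p∪q⁺ (inj₁ (x∈⁅x⁆ x)))) (below′ j (x∈p∪q⁺ (inj₂ j∈S))) , Py)
... | inj₂ j∈S  | inj₂ j′∈S =
  inj₁ (toℕ-injective (≤-antisym (below′ j (x∈p∪q⁺ (inj₂ j∈S))) (below j′ (x∈p∪q⁺ (inj₂ j′∈S)))))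

lookup≡nth-toList : ∀ {n} (b : Vec Bool n) i → lookup b i ≡ nth (toList b) (toℕ i)
lookup≡nth-toList (_ ∷ _) zero    = refl
lookup≡nth-toList (_ ∷ b) (suc i) = lookup≡nth-toList b i

onesSpreadIn⇒≪ : ∀ {n} k (b : Vec Bool n) {P : ℕ → Set} → IsInterval P →
  OnesSpreadIn k (nth (toList b)) P →
  ∀ {x y} → P (toℕ x) → P (toℕ y) → x ≪[ k , b ] y
onesSpreadIn⇒≪ k b interval spread {x} {y} Px Py S ∣S∣≡k-1 x∉S y∉S (∣x∪S∣≡k , j , j∈ , bj , below)
  with maximum (⁅ y ⁆ ∪ S) (y , x∈p∪q⁺ (inj₁ (x∈⁅x⁆ y)))
... | j′ , j′-max@(j′∈ , below′) = ∣y∪S∣≡k , j′ , j′∈ , bj′ , below′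
  where
  ∣y∪S∣≡1+∣S∣ : ∣ ⁅ y ⁆ ∪ S ∣ ≡ suc ∣ S ∣
  ∣y∪S∣≡1+∣S∣ = ∣⁅x⁆∪p∣≡1+∣p∣ y S y∉S

  ∣y∪S∣≡k : ∣ ⁅ y ⁆ ∪ S ∣ ≡ k
  ∣y∪S∣≡k = trans ∣y∪S∣≡1+∣S∣ (trans (sym (∣⁅x⁆∪p∣≡1+∣p∣ x S x∉S)) ∣x∪S∣≡k)

  k-1≤j′ : k ∸ 1 ≤ toℕ j′
  k-1≤j′ = subst (_≤ toℕ j′) ∣S∣≡k-1 (s≤s⁻¹ (subst (_≤ suc (toℕ j′)) ∣y∪S∣≡1+∣S∣
             (∀∈p<m⇒∣p∣≤m (⁅ y ⁆ ∪ S) (suc (toℕ j′)) (λ i i∈ → s≤s (below′ i i∈)))))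

  bj′ : lookup b j′ ≡ true
  bj′ with maxima-equal-or-within interval Px Py (j∈ , below) j′-max
  ... | inj₁ refl = bj
  ... | inj₂ (Pj , Pj′) = begin
    lookup b j′                ≡⟨ lookup≡nth-toList b j′ ⟩
    nth (toList b) (toℕ j′)    ≡⟨ spread Pj Pj′ (trans (sym (lookup≡nth-toList b j)) bj) k-1≤j′ ⟩
    true                       ∎

InBlock-isInterval : ∀ t a → IsInterval (λ z → InBlock t z a)
InBlock-isInterval t a (lo , _) (_ , hi) p≤z z≤q = ≤-trans lo p≤z , ≤-<-trans z≤q hi

InBlock-[] : ∀ t {z} → ¬ InBlock t z []
InBlock-[] zero    (_ , ())
InBlock-[] (suc t) (_ , ())

InBlock-head⁺ : ∀ m a {z} → z < m → InBlock 0 z (m ∷ a)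
InBlock-head⁺ m a z<m = z≤n , subst (_ <_) (sym (+-identityʳ m)) z<m

InBlock-head⁻ : ∀ m a {z} → InBlock 0 z (m ∷ a) → z < m
InBlock-head⁻ m a (_ , z<m+0) = subst (_ <_) (+-identityʳ m) z<m+0

InBlock-tail : ∀ t m a {z} → InBlock (suc t) z (m ∷ a) → ∃[ z′ ] (z ≡ m + z′ × InBlock t z′ a)
InBlock-tail t m a (lo , hi) with m≤n⇒∃[o]m+o≡n (≤-trans (m≤m+n m _) lo)
... | z′ , refl = z′ , refl , +-cancelˡ-≤ m _ _ lo , +-cancelˡ-< m _ _ hi

ConstantOnBlocks : List ℕ → (ℕ → Bool) → Set
ConstantOnBlocks a f = ∀ t {z w} → InBlock t z a → InBlock t w a → f z ≡ f w

OnesSpreadOnBlocks : ℕ → List ℕ → (ℕ → Bool) → Set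
OnesSpreadOnBlocks k a f = ∀ t → OnesSpreadIn k f (λ z → InBlock t z a)

constant⇒onesSpread : ∀ k {a f} → ConstantOnBlocks a f → OnesSpreadOnBlocks k a f
constant⇒onesSpread k constant t z∈t w∈t fz≡true _ = trans (sym (constant t z∈t w∈t)) fz≡true

nth-replicate-++ : ∀ m (c : Bool) L {z} → z < m → nth (replicate m c ++ L) z ≡ c
nth-replicate-++ (suc m) c L {zero}  _         = refl
nth-replicate-++ (suc m) c L {suc z} (s≤s z<m) = nth-replicate-++ m c L z<m

nth-replicate-++-+ : ∀ m (c : Bool) L z → nth (replicate m c ++ L) (m + z) ≡ nth L z
nth-replicate-++-+ zero    c L z = refl
nth-replicate-++-+ (suc m) c L z = nth-replicate-++-+ m c L z

replicate-++-∷ : ∀ m (c : Bool) L → replicate m c ++ c ∷ L ≡ replicate (suc m) c ++ L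
replicate-++-∷ zero    c L = refl
replicate-++-∷ (suc m) c L = cong (c ∷_) (replicate-++-∷ m c L)

∷-constantOnBlocks : ∀ m c L {a} → ConstantOnBlocks a (nth L) →
  ConstantOnBlocks (m ∷ a) (nth (replicate m c ++ L))
∷-constantOnBlocks m c L {a} constant zero z∈0 w∈0 =
  trans (nth-replicate-++ m c L (InBlock-head⁻ m a z∈0)) (sym (nth-replicate-++ m c L (InBlock-head⁻ m a w∈0)))
∷-constantOnBlocks m c L {a} constant (suc t) z∈t w∈t
  with InBlock-tail t m a z∈t | InBlock-tail t m a w∈t
... | z′ , refl , z′∈t | w′ , refl , w′∈t = begin
  nth (replicate m c ++ L) (m + z′)  ≡⟨ nth-replicate-++-+ m c L z′ ⟩
  nth L z′                           ≡⟨ constant t z′∈t w′∈t ⟩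
  nth L w′                           ≡⟨ nth-replicate-++-+ m c L w′ ⟨
  nth (replicate m c ++ L) (m + w′)  ∎

runsFrom-constantOnBlocks : ∀ c m L → ConstantOnBlocks (runsFrom c m L) (nth (replicate m c ++ L))
runsFrom-constantOnBlocks c m [] = ∷-constantOnBlocks m c [] (λ t z∈t → contradiction z∈t (InBlock-[] t))
runsFrom-constantOnBlocks c m (y ∷ L) with y ≟ᵇ c
... | yes refl = subst (λ L′ → ConstantOnBlocks (runsFrom c (suc m) L) (nth L′)) (sym (replicate-++-∷ m c L))
                   (runsFrom-constantOnBlocks c (suc m) L)
... | no _     = ∷-constantOnBlocks m c (y ∷ L) (runsFrom-constantOnBlocks y 1 L)

runs-constantOnBlocks : ∀ L → ConstantOnBlocks (runs L) (nth L)
runs-constantOnBlocks []      t z∈t = contradiction z∈t (InBlock-[] t)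
runs-constantOnBlocks (c ∷ L) = runsFrom-constantOnBlocks c 1 L

mergeFirstTwo-onesSpread : ∀ k a f → ConstantOnBlocks a f → f 0 ≡ false → f (k ∸ 1) ≡ true →
  OnesSpreadOnBlocks k (mergeFirstTwo a) f
mergeFirstTwo-onesSpread k []            f constant _ _ = constant⇒onesSpread k constant
mergeFirstTwo-onesSpread k (a₁ ∷ [])     f constant _ _ = constant⇒onesSpread k constant
mergeFirstTwo-onesSpread k (a₁ ∷ a₂ ∷ a) f constant f0≡false fk-1≡true (suc t) z∈t w∈t =
  constant⇒onesSpread k constant (suc (suc t)) (unmerge z∈t) (unmerge w∈t)
  where
  unmerge : ∀ {v} → InBlock (suc t) v ((a₁ + a₂) ∷ a) → InBlock (suc (suc t)) v (a₁ ∷ a₂ ∷ a)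
  unmerge {v} (lo , hi) = subst (_≤ v) (+-assoc a₁ a₂ _) lo , subst (v <_) (+-assoc a₁ a₂ _) hi
mergeFirstTwo-onesSpread k (a₁ ∷ a₂ ∷ a) f constant f0≡false fk-1≡true zero {w = w} _ w∈0 _ k-1≤w =
  begin
    f w        ≡⟨ constant 1 (in-second-run a₁≤w w<a₁+a₂) (in-second-run a₁≤k-1 (≤-<-trans k-1≤w w<a₁+a₂)) ⟩
    f (k ∸ 1)  ≡⟨ fk-1≡true ⟩
    true       ∎
  where
  in-second-run : ∀ {v} → a₁ ≤ v → v < a₁ + a₂ → InBlock 1 v (a₁ ∷ a₂ ∷ a)
  in-second-run {v} lo hi = subst (_≤ v) (sym (+-identityʳ a₁)) lo
                          , subst (v <_) (cong (a₁ +_) (sym (+-identityʳ a₂))) hi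

  a₁≤k-1 : a₁ ≤ k ∸ 1
  a₁≤k-1 = ≮⇒≥ λ k-1<a₁ → contradiction
    (trans (sym f0≡false) (trans (constant 0 (InBlock-head⁺ a₁ (a₂ ∷ a) (≤-<-trans z≤n k-1<a₁))
                                             (InBlock-head⁺ a₁ (a₂ ∷ a) k-1<a₁)) fk-1≡true))
    λ ()

  w<a₁+a₂ : w < a₁ + a₂
  w<a₁+a₂ = InBlock-head⁻ (a₁ + a₂) a w∈0

  a₁≤w : a₁ ≤ w
  a₁≤w = ≤-trans a₁≤k-1 k-1≤w

shortSeq-onesSpread : ∀ {n} k (b : Vec Bool n) → nth (toList b) 0 ≡ false →
  OnesSpreadOnBlocks k (shortSeq k b) (nth (toList b))
shortSeq-onesSpread k b f0≡false with nth (toList b) (k ∸ 1) in fk-1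
... | true  = mergeFirstTwo-onesSpread k _ _ (runs-constantOnBlocks (toList b)) f0≡false fk-1
... | false = constant⇒onesSpread k (runs-constantOnBlocks (toList b))

proposition4 : (k n : ℕ) → 2 ≤ k → 1 ≤ n → (b : Vec Bool n) →
    (∀ (i : Fin n) → toℕ i < k ∸ 1 → lookup b i ≡ false) →
    (x y : Fin n) → SameBlock k b x y →
    (x ≪[ k , b ] y) × (y ≪[ k , b ] x)
proposition4 k n (s≤s (s≤s z≤n)) (s≤s z≤n) b zeros x y (t , _ , x∈t , y∈t) =
  ≪-within-block x∈t y∈t , ≪-within-block y∈t x∈t
  where
  ≪-within-block : ∀ {u v} → InBlock t (toℕ u) (shortSeq k b) → InBlock t (toℕ v) (shortSeq k b) →
    u ≪[ k , b ] v
  ≪-within-block = onesSpreadIn⇒≪ k b (InBlock-isInterval t (shortSeq k b))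
    (shortSeq-onesSpread k b (trans (sym (lookup≡nth-toList b zero)) (zeros zero (s≤s z≤n))) t)
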